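{- The forgetful functor $\mathcal{F}:A/\mathcal{U}\to\mathcal{U}$ preserves limits. That is, for every graph $\Gamma$, every $A$-diagram $F$ over $\Gamma$, and every limiting $A$-cone $(C,r,K)$ over $F$, the underlying cone in $\mathcal{U}$ is limiting. Here the underlying cone has: - tip $\mathsf{pr}_1(C)$, - legs $\mathsf{pr}_1(r_i)$, - homotopies $\mathsf{pr}_1(K_{i,j,g})$, and it lies over the underlying diagram $(\mathsf{pr}_1(F_i),\mathsf{pr}_1(F_{i,j,g}))$.
   Context: Work in homotopy type theory. Fix a universe $\mathcal{U}$ and $A:\mathcal{U}$. Coslices. $A/\mathcal{U}$ has objects $(X,f_X)$ with $f_X:A\to X$. Its maps are $$(X,f_X)\to_A(Y,f_Y):=\sum_{h:X\to Y}\prod_a h(f_X(a))=f_Y(a),$$ with the evident composition. Graphs and diagrams. A graph $\Gamma$ consists of $\Gamma_0$ and $\Gamma_1(i,j)$. An $A$-diagram $F$ over $\Gamma$ consists of objects $F_i$ and maps $F_{i,j,g}:F_i\to_A F_j$. Limits in $A/\mathcal{U}$. A cone over $F$ with tip $C$ consists of maps $r_i:C\to_A F_i$ and identifications $K_{i,j,g}:F_{i,j,g}\circ r_i=r_j$. It is limiting if for every $T$, postcomposition from $T\to_A C$ to the type of cones with tip $T$ is an equivalence. Limits in $\mathcal{U}$. In $\mathcal{U}$, a cone consists of functions $r_i:C\to D_i$ and homotopies $D_{i,j,g}\circ r_i\sim r_j$. It is limiting if for every type $X$, postcomposition $(X\to C)\to\mathsf{Cone}(X)$ is an equivalence. -}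

{-# OPTIONS --without-K #-}
module Defs where

open import Level using (Level; _⊔_; Setω) renaming (suc to lsuc)
open import Data.Product using (Σ; Σ-syntax; _,_; proj₁; proj₂)
open import Relation.Binary.PropositionalEquality
  using (_≡_; refl; sym; trans; cong)
open import Axiom.Extensionality.Propositional using (Extensionality)

isContr : ∀ {ℓ} → Set ℓ → Set ℓ
isContr X = Σ[ x ∈ X ] (∀ y → x ≡ y)

fiber : ∀ {a b} {X : Set a} {Y : Set b} → (X → Y) → Y → Set (a ⊔ b)
fiber {X = X} f y = Σ[ x ∈ X ] (f x ≡ y)

isEquiv : ∀ {a b} {X : Set a} {Y : Set b} → (X → Y) → Set (a ⊔ b)
isEquiv f = ∀ y → isContr (fiber f y)

happly : ∀ {a b} {X : Set a} {Y : Set b} {f g : X → Y} → f ≡ g → ∀ x → f x ≡ g x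
happly p x = cong (λ φ → φ x) p

FunExt : Setω
FunExt = ∀ {a b} → Extensionality a b

record Graph (ℓ : Level) : Set (lsuc ℓ) where
  field
    Γ₀ : Set ℓ
    Γ₁ : Γ₀ → Γ₀ → Set ℓ
open Graph public

record Diagram {ℓ} (Γ : Graph ℓ) : Set (lsuc ℓ) where
  field
    D₀ : Γ₀ Γ → Set ℓ
    D₁ : ∀ i j → Γ₁ Γ i j → D₀ i → D₀ j
open Diagram public

Cone : ∀ {ℓ} {Γ : Graph ℓ} → Diagram Γ → Set ℓ → Set ℓ
Cone {Γ = Γ} D C =
  Σ[ r ∈ (∀ i → C → D₀ D i) ]
    (∀ i j (g : Γ₁ Γ i j) → ∀ x → D₁ D i j g (r i x) ≡ r j x)

postcomp : ∀ {ℓ} {Γ : Graph ℓ} (D : Diagram Γ) {C : Set ℓ} → Cone D C →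
           (X : Set ℓ) → (X → C) → Cone D X
postcomp D (r , K) X h = (λ i x → r i (h x)) , (λ i j g x → K i j g (h x))

isLimitCone : ∀ {ℓ} {Γ : Graph ℓ} (D : Diagram Γ) {C : Set ℓ} → Cone D C → Set (lsuc ℓ)
isLimitCone {ℓ} D {C} c = (X : Set ℓ) → isEquiv (postcomp D c X)

module _ {ℓ} (A : Set ℓ) where

  Coslice : Set (lsuc ℓ)
  Coslice = Σ[ X ∈ Set ℓ ] (A → X)

  _→A_ : Coslice → Coslice → Set ℓ
  (X , fX) →A (Y , fY) = Σ[ h ∈ (X → Y) ] (∀ a → h (fX a) ≡ fY a)

  compA : {X Y Z : Coslice} → Y →A Z → X →A Y → X →A Z
  compA (k , q) (h , p) = (λ x → k (h x)) , (λ a → trans (cong k (p a)) (q a))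

  record ADiagram (Γ : Graph ℓ) : Set (lsuc ℓ) where
    field
      F₀ : Γ₀ Γ → Coslice
      F₁ : ∀ i j → Γ₁ Γ i j → F₀ i →A F₀ j
  open ADiagram public

  ACone : {Γ : Graph ℓ} → ADiagram Γ → Coslice → Set ℓ
  ACone {Γ} F C =
    Σ[ r ∈ (∀ i → C →A F₀ F i) ]
      (∀ i j (g : Γ₁ Γ i j) → compA {C} {F₀ F i} {F₀ F j} (F₁ F i j g) (r i) ≡ r j)

  private
    assoc-pt : ∀ {X Y Z W : Set ℓ} (h : X → Y) (k : Y → Z) (l : Z → W)
               {x : X} {y : Y} {z : Z} {w : W}
               (p : h x ≡ y) (q : k y ≡ z) (s : l z ≡ w) →
               trans (cong (λ u → l (k u)) p) (trans (cong l q) s)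
                 ≡ trans (cong l (trans (cong k p) q)) s
    assoc-pt h k l refl refl s = refl

  assocA : FunExt → {X Y Z W : Coslice}
           (l : Z →A W) (k : Y →A Z) (h : X →A Y) →
           compA {X} {Y} {W} (compA {Y} {Z} {W} l k) h
             ≡ compA {X} {Z} {W} l (compA {X} {Y} {Z} k h)
  assocA fe (l , s) (k , q) (h , p) =
    cong ((λ x → l (k (h x))) ,_)
         (fe (λ a → assoc-pt h k l (p a) (q a) (s a)))

  postcompA : FunExt → {Γ : Graph ℓ} (F : ADiagram Γ) (C : Coslice) →
              ACone F C → (T : Coslice) → T →A C → ACone F T
  postcompA fe F C (r , K) T h =
    (λ i → compA {T} {C} {F₀ F i} (r i) h) ,
    (λ i j g → trans
      (sym (assocA fe {T} {C} {F₀ F i} {F₀ F j} (F₁ F i j g) (r i) h))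
      (cong (λ m → compA {T} {C} {F₀ F j} m h) (K i j g)))

  isLimitACone : FunExt → {Γ : Graph ℓ} (F : ADiagram Γ) (C : Coslice) →
                 ACone F C → Set (lsuc ℓ)
  isLimitACone fe F C c = (T : Coslice) → isEquiv (postcompA fe F C c T)

  underlyingDiagram : {Γ : Graph ℓ} → ADiagram Γ → Diagram Γ
  underlyingDiagram F = record
    { D₀ = λ i → proj₁ (F₀ F i)
    ; D₁ = λ i j g → proj₁ (F₁ F i j g) }

  underlyingCone : {Γ : Graph ℓ} (F : ADiagram Γ) (C : Coslice) →
                   ACone F C → Cone (underlyingDiagram F) (proj₁ C)
  underlyingCone F C (r , K) =
    (λ i → proj₁ (r i)) , (λ i j g → happly (cong proj₁ (K i j g)))

{-# OPTIONS --without-K #-}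
-- For a type X, the coslice object X ⊎ A under A (with the right injection) is free on X:
-- maps out of it are the same as functions out of X. Restricting along inj₁ therefore identifies
-- A-cones with tip X ⊎ A with cones over the underlying diagram with tip X; on legs this is the
-- freeness equivalence, and on the naturality witnesses it is the action of that equivalence on
-- paths followed by happly, both equivalences by function extensionality. Under these
-- identifications postcomposition with the underlying cone becomes postcomposition with the
-- A-cone, which is an equivalence by hypothesis.
module Submission where

open import Defs
open import Level using (Level)
open import Function.Base using (_∘_)
open import Function.Bundles using (_↔_; Inverse; mk↔ₛ′)
open import Function.Properties.Inverse using (↔-sym; ↔-trans)
open import Function.Properties.Inverse.HalfAdjointEquivalence using (_≃_; ↔⇒≃)
open import Data.Product using (Σ; _,_; proj₁; proj₂)
open import Data.Product.Function.Dependent.Propositional using (Σ-↔)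
open import Data.Sum using (_⊎_; inj₁; inj₂; [_,_])
open import Relation.Binary.PropositionalEquality
  using (_≡_; refl; sym; trans; cong; cong₂; subst; trans-symˡ; trans-cong; sym-cong; cong-∘;
         module ≡-Reasoning)

open Inverse using (to)

private
  variable
    a b c : Level
    X Y : Set a

↔⇒isEquiv : (e : X ↔ Y) → isEquiv (to e)
↔⇒isEquiv e y = (from y , right-inverse-of y) , contraction y
  where
  open _≃_ (↔⇒≃ e) using (from; left-inverse-of; right-inverse-of; left-right)

  fiber-≡ : ∀ {x x'} (p : x' ≡ x) {q : to e x' ≡ to e x} → cong (to e) p ≡ q →
            _≡_ {A = fiber (to e) (to e x)} (x' , q) (x , refl)
  fiber-≡ refl refl≡q = cong (_ ,_) (sym refl≡q)

  contraction : ∀ y (w : fiber (to e) y) → (from y , right-inverse-of y) ≡ w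
  contraction .(to e x) (x , refl) = (fiber-≡ (left-inverse-of x) (left-right x))

isEquiv⇒↔ : {f : X → Y} → isEquiv f → X ↔ Y
isEquiv⇒↔ {f = f} f-equiv = mk↔ₛ′ f
  (λ y → proj₁ (proj₁ (f-equiv y)))
  (λ y → proj₂ (proj₁ (f-equiv y)))
  (λ x → cong proj₁ (proj₂ (f-equiv (f x)) (x , refl)))

isEquiv-≗ : FunExt → {f g : X → Y} → (∀ x → f x ≡ g x) → isEquiv f → isEquiv g
isEquiv-≗ fe f≗g = subst isEquiv (fe f≗g)

cong-↔ : (e : X ↔ Y) {x y : X} → (x ≡ y) ↔ (to e x ≡ to e y)
cong-↔ e {x} {y} = mk↔ₛ′ (cong (to e)) uncong cong-uncong uncong-cong
  where
  open _≃_ (↔⇒≃ e) using (from; left-inverse-of; right-inverse-of; left-right)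
  open ≡-Reasoning

  uncong : to e x ≡ to e y → x ≡ y
  uncong q = trans (sym (left-inverse-of x)) (trans (cong from q) (left-inverse-of y))

  uncong-cong : ∀ p → uncong (cong (to e) p) ≡ p
  uncong-cong refl = trans-symˡ (left-inverse-of x)

  conjugate-cong : ∀ {b b'} (q : b ≡ b') →
    trans (sym (right-inverse-of b)) (trans (cong (to e ∘ from) q) (right-inverse-of b')) ≡ q
  conjugate-cong {b} refl = trans-symˡ (right-inverse-of b)

  cong-uncong : ∀ q → cong (to e) (uncong q) ≡ q
  cong-uncong q = begin
    cong (to e) (trans (sym (left-inverse-of x)) (trans (cong from q) (left-inverse-of y)))
      ≡⟨ sym (trans-cong (sym (left-inverse-of x))) ⟩
    trans (cong (to e) (sym (left-inverse-of x))) (cong (to e) (trans (cong from q) (left-inverse-of y)))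
      ≡⟨ cong₂ trans (sym (sym-cong (left-inverse-of x))) (sym (trans-cong (cong from q))) ⟩
    trans (sym (cong (to e) (left-inverse-of x)))
          (trans (cong (to e) (cong from q)) (cong (to e) (left-inverse-of y)))
      ≡⟨ cong₂ (λ u v → trans (sym u) (trans (cong (to e) (cong from q)) v)) (left-right x) (left-right y) ⟩
    trans (sym (right-inverse-of (to e x)))
          (trans (cong (to e) (cong from q)) (right-inverse-of (to e y)))
      ≡⟨ cong (λ r → trans (sym (right-inverse-of (to e x))) (trans r (right-inverse-of (to e y))))
              (sym (cong-∘ q)) ⟩
    trans (sym (right-inverse-of (to e x)))
          (trans (cong (to e ∘ from) q) (right-inverse-of (to e y)))
      ≡⟨ conjugate-cong q ⟩
    q ∎

module _ (fe : FunExt) where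

  Π-cong-↔ : {I : Set a} {B : I → Set b} {B' : I → Set c} →
             (∀ i → B i ↔ B' i) → ((i : I) → B i) ↔ ((i : I) → B' i)
  Π-cong-↔ e = mk↔ₛ′ (λ f i → to (e i) (f i)) (λ f i → Inverse.from (e i) (f i))
    (λ f → fe λ i → Inverse.strictlyInverseˡ (e i) (f i))
    (λ f → fe λ i → Inverse.strictlyInverseʳ (e i) (f i))

  module _ (f : X → Y) where

    private
      HomotopyFrom : Set _
      HomotopyFrom = Σ (X → Y) (λ g → ∀ x → f x ≡ g x)

      homotopyFrom-contraction : (u : HomotopyFrom) → (f , λ _ → refl) ≡ u
      homotopyFrom-contraction (g , H) =
        cong (λ φ → (λ x → proj₁ (φ x)) , (λ x → proj₂ (φ x))) (fe λ x → singleton-contraction (g x , H x))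
        where
        singleton-contraction : ∀ {x} (v : Σ Y (f x ≡_)) → (f x , refl) ≡ v
        singleton-contraction (_ , refl) = refl

      -- re-centred so that it is refl at the centre; this is what makes ~-ind-β hold
      homotopyFrom-path : (u : HomotopyFrom) → (f , λ _ → refl) ≡ u
      homotopyFrom-path u =
        trans (sym (homotopyFrom-contraction (f , λ _ → refl))) (homotopyFrom-contraction u)

    ~-ind : (P : (g : X → Y) → (∀ x → f x ≡ g x) → Set c) → P f (λ _ → refl) →
            ∀ g H → P g H
    ~-ind P base g H = subst (λ u → P (proj₁ u) (proj₂ u)) (homotopyFrom-path (g , H)) base

    ~-ind-β : (P : (g : X → Y) → (∀ x → f x ≡ g x) → Set c) (base : P f (λ _ → refl)) →
              ~-ind P base f (λ _ → refl) ≡ base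
    ~-ind-β P base =
      cong (λ q → subst (λ u → P (proj₁ u) (proj₂ u)) q base) (trans-symˡ (homotopyFrom-contraction _))

    happly-↔ : {g : X → Y} → (f ≡ g) ↔ (∀ x → f x ≡ g x)
    happly-↔ = mk↔ₛ′ happly funext (happly-funext _) funext-happly
      where
      funext : ∀ {g} → (∀ x → f x ≡ g x) → f ≡ g
      funext = ~-ind (λ g _ → f ≡ g) refl _

      happly-funext : ∀ g (H : ∀ x → f x ≡ g x) → happly (funext H) ≡ H
      happly-funext = ~-ind (λ g H → happly (funext H) ≡ H)
                            (cong happly (~-ind-β (λ g _ → f ≡ g) refl))

      funext-happly : ∀ {g} (p : f ≡ g) → funext (happly p) ≡ p
      funext-happly refl = ~-ind-β (λ g _ → f ≡ g) refl

module _ {ℓ : Level} {A : Set ℓ} where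

  →A-≡ : (fe : FunExt) {Z W : Coslice A} {h k : proj₁ Z → proj₁ W} (H : ∀ z → h z ≡ k z)
         (p : ∀ a → k (proj₂ Z a) ≡ proj₂ W a) →
         _≡_ {A = _→A_ A Z W} (h , λ a → trans (H (proj₂ Z a)) (p a)) (k , p)
  →A-≡ fe {Z} {W} {h} H p = ~-ind fe h
    (λ k H → ∀ p → _≡_ {A = _→A_ A Z W} (h , λ a → trans (H (proj₂ Z a)) (p a)) (k , p))
    (λ _ → refl) _ H p

  underlyingCone-postcompA : (fe : FunExt) {Γ : Graph ℓ} (F : ADiagram A Γ) (C : Coslice A)
    (c : ACone A F C) (T : Coslice A) (t : _→A_ A T C) →
    underlyingCone A F T (postcompA A fe F C c T t)
      ≡ postcomp (underlyingDiagram A F) (underlyingCone A F C c) (proj₁ T) (proj₁ t)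
  underlyingCone-postcompA fe F C (r , K) T t =
    cong ((λ i z → proj₁ (r i) (proj₁ t z)) ,_) (fe λ i → fe λ j → fe λ g → fe λ z →
      trans (cong (λ q → happly q z) (cong-proj₁-unpair _ _)) (happly-precompose (K i j g) z))
    where
    -- assocA only moves the A-component, so it disappears under proj₁
    cong-proj₁-unpair : {B : Set ℓ} {Q : B → Set ℓ} {k : B} {p p' : Q k} {v : Σ B Q}
                        (π : p ≡ p') (β : (k , p) ≡ v) →
                        cong proj₁ (trans (sym (cong (k ,_) π)) β) ≡ cong proj₁ β
    cong-proj₁-unpair refl β = refl

    happly-precompose : ∀ {W} {u v : _→A_ A C W} (K : u ≡ v) z →
      happly (cong proj₁ (cong (λ m → compA A {T} {C} {W} m t) K)) z ≡ happly (cong proj₁ K) (proj₁ t z)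
    happly-precompose refl z = refl

  module _ (fe : FunExt) (X : Set ℓ) where

    free : Coslice A
    free = (X ⊎ A) , inj₂

    free-↔ : (Y : Coslice A) → _→A_ A free Y ↔ (X → proj₁ Y)
    free-↔ (Y , f) = mk↔ₛ′ (λ k x → proj₁ k (inj₁ x)) (λ s → [ s , f ] , λ _ → refl) (λ _ → refl)
                            extend-restrict
      where
      extend-restrict : (k : _→A_ A free (Y , f)) → ([ proj₁ k ∘ inj₁ , f ] , λ _ → refl) ≡ k
      extend-restrict (k , p) =
        trans (cong ([ k ∘ inj₁ , f ] ,_) (fe λ a → sym (trans-symˡ (p a)))) (→A-≡ fe restrict-extend p)
        where
        restrict-extend : ∀ z → [ k ∘ inj₁ , f ] z ≡ k z
        restrict-extend (inj₁ x) = refl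
        restrict-extend (inj₂ a) = sym (p a)

    restrict-↔ : {Γ : Graph ℓ} (F : ADiagram A Γ) → ACone A F free ↔ Cone (underlyingDiagram A F) X
    restrict-↔ F =
      Σ-↔ (Π-cong-↔ fe λ i → free-↔ (F₀ F i))
          (Π-cong-↔ fe λ i → Π-cong-↔ fe λ j → Π-cong-↔ fe λ g →
             ↔-trans (cong-↔ (free-↔ (F₀ F j))) (happly-↔ fe _))

    restrict-↔-to : {Γ : Graph ℓ} (F : ADiagram A Γ) (c : ACone A F free) →
      to (restrict-↔ F) c ≡ postcomp (underlyingDiagram A F) (underlyingCone A F free c) X inj₁
    restrict-↔-to F (r , K) =
      cong ((λ i x → proj₁ (r i) (inj₁ x)) ,_) (fe λ i → fe λ j → fe λ g → fe λ x → happly-restrict (K i j g) x)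
      where
      happly-restrict : ∀ {W} {u v : _→A_ A free W} (K : u ≡ v) x →
        happly (cong (λ k x → proj₁ k (inj₁ x)) K) x ≡ happly (cong proj₁ K) (inj₁ x)
      happly-restrict refl x = refl

mainTheorem14 : (fe : FunExt) {ℓ : Level} (A : Set ℓ) (Γ : Graph ℓ) (F : ADiagram A Γ)
    (C : Coslice A) (c : ACone A F C) →
    isLimitACone A fe F C c →
    isLimitCone (underlyingDiagram A F) (underlyingCone A F C c)
mainTheorem14 fe A Γ F C c lim X = isEquiv-≗ fe commutes (↔⇒isEquiv e)
  where
  e : (X → proj₁ C) ↔ Cone (underlyingDiagram A F) X
  e = ↔-trans (↔-sym (free-↔ fe X C)) (↔-trans (isEquiv⇒↔ (lim (free fe X))) (restrict-↔ fe X F))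

  commutes : ∀ h → to e h ≡ postcomp (underlyingDiagram A F) (underlyingCone A F C c) X h
  commutes h = trans (restrict-↔-to fe X F _)
    (cong (λ κ → postcomp (underlyingDiagram A F) κ X inj₁)
          (underlyingCone-postcompA fe F C c (free fe X) (Inverse.from (free-↔ fe X C) h)))
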